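{- Let $N\in\mathbb{N}$ and $X\in\mathbb{Z}^{\mathcal{D}_N}$. Then both eta quotients $f:=\eta^X$ and $F_N/f$ are holomorphic if and only if $X\in B_N\cdot[0,1]^{\mathcal{D}_N}$, i.e. $X=B_Ny$ for some $y\in[0,1]^{\mathcal{D}_N}$.
   Context: Let $\eta(z)=q^{1/24}\prod_{n\ge1}(1-q^n)$, $q=e^{2\pi i z}$, $z$ in the upper half plane, $\eta_d(z)=\eta(dz)$. Let $\mathcal{D}_N$ be the set of positive divisors of $N$ and for $X\in\mathbb{Z}^{\mathcal{D}_N}$ let $\eta^X=\prod_{d\in\mathcal{D}_N}\eta_d^{X_d}$. The order matrix $A_N\in\mathbb{Z}^{\mathcal{D}_N\times\mathcal{D}_N}$ is $A_N(t,d)=\frac{N\gcd(d,t)^2}{d\gcd(t^2,N)}$ (it is $24$ times the order of $\eta_d$ at the cusp $1/t$ of $\Gamma_0(N)$); it is invertible over $\mathbb{Q}$. The eta quotient $\eta^X$ is holomorphic (no poles at cusps of $\Gamma_0(N)$) iff $A_NX\ge0$ componentwise. For $t\in\mathcal{D}_N$ let $m_{t,N}$ be the smallest positive integer such that $m_{t,N}A_N^{ -1}(\cdot,t)\in\mathbb{Z}^{\mathcal{D}_N}$, where $A_N^{ -1}(\cdot,t)$ is the column of $A_N^{ -1}$ indexed by $t$, and define $B_N\in\mathbb{Z}^{\mathcal{D}_N\times\mathcal{D}_N}$ by $B_N(\cdot,t)=m_{t,N}A_N^{ -1}(\cdot,t)$. Define $F_N=\prod_{t\in\mathcal{D}_N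}\eta^{B_N(\cdot,t)}$.
   Formalization: The vector $y\in[0,1]^{\mathcal{D}_N}$ has rational entries. -}

module Defs where

open import Data.Nat as ℕ using (ℕ; zero; suc; _≤_)
open import Data.Nat.GCD using (gcd)
open import Data.Nat.Divisibility using (_∣?_)
open import Data.Integer as ℤ using (ℤ; +_)
open import Data.Rational as ℚ using (ℚ; 0ℚ; 1ℚ)
open import Data.List using (List; filter; upTo; foldr; map)
open import Data.List.Membership.Propositional using (_∈_)
open import Data.Product using (∃; _×_)
open import Relation.Binary.PropositionalEquality using (_≡_)
open import Relation.Nullary.Decidable using (Dec; yes; no)

-- The positive divisors of N (for N ≥ 1): d ∈ {0,…,N} with d ∣ N.
divisors : ℕ → List ℕ
divisors N = filter (λ d → d ∣? N) (upTo (suc N))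

-- Vectors in ℚ^{D_N} / ℤ^{D_N} are represented as functions on ℕ;
-- only their values at divisors of N are ever used.
QVec : Set
QVec = ℕ → ℚ

ZVec : Set
ZVec = ℕ → ℤ

-- Matrices: M t d = entry in row t, column d.
QMat : Set
QMat = ℕ → ℕ → ℚ

toℚ : ℤ → ℚ
toℚ z = z ℚ./ 1

sumℚ : List ℚ → ℚ
sumℚ = foldr ℚ._+_ 0ℚ

ΣD : ℕ → (ℕ → ℚ) → ℚ
ΣD N f = sumℚ (map f (divisors N))

-- exact natural-number quotient a / b (b = 0 never occurs for divisors)
divℕ : ℕ → ℕ → ℕ
divℕ a zero = 0
divℕ a (suc k) = a ℕ./ suc k

-- Order matrix A_N(t,d) = N gcd(d,t)^2 / (d gcd(t^2,N))  (an integer)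
A : ℕ → ℕ → ℕ → ℚ
A N t d = toℚ (+ divℕ (N ℕ.* (gcd d t ℕ.* gcd d t)) (d ℕ.* gcd (t ℕ.* t) N))

mulVec : ℕ → QMat → QVec → QVec
mulVec N M v t = ΣD N (λ d → M t d ℚ.* v d)

δ : ℕ → ℕ → ℚ
δ t s with t ℕ.≟ s
... | yes _ = 1ℚ
... | no _ = 0ℚ

IsInverseA : ℕ → QMat → Set
IsInverseA N Ainv =
  (∀ t s → t ∈ divisors N → s ∈ divisors N →
     ΣD N (λ d → A N t d ℚ.* Ainv d s) ≡ δ t s)
  × (∀ t s → t ∈ divisors N → s ∈ divisors N →
     ΣD N (λ d → Ainv t d ℚ.* A N d s) ≡ δ t s)

IsIntVec : ℕ → QVec → Set
IsIntVec N v = ∀ d → d ∈ divisors N → ∃ λ (z : ℤ) → v d ≡ toℚ z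

IsMinMult : ℕ → QMat → ℕ → ℕ → Set
IsMinMult N Ainv t m =
  1 ≤ m
  × IsIntVec N (λ d → toℚ (+ m) ℚ.* Ainv d t)
  × (∀ m′ → 1 ≤ m′ → IsIntVec N (λ d → toℚ (+ m′) ℚ.* Ainv d t) → m ≤ m′)

B : QMat → (ℕ → ℕ) → QMat
B Ainv m d t = toℚ (+ m t) ℚ.* Ainv d t

-- exponent vector of F_N = ∏_t η^{B_N(·,t)} : d ↦ Σ_t B_N(d,t)
FExp : ℕ → QMat → (ℕ → ℕ) → QVec
FExp N Ainv m d = ΣD N (λ t → B Ainv m d t)

-- η^v holomorphic  ⇔  A_N v ≥ 0 componentwise
Holomorphic : ℕ → QVec → Set
Holomorphic N v = ∀ t → t ∈ divisors N → 0ℚ ℚ.≤ mulVec N (λ t′ d → A N t′ d) v t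

{-# OPTIONS --safe #-}
-- Since A_N B_N = diag(m_t), writing X = B_N y gives A_N X = (m_t y_t)_t and, as the
-- exponent vector of F_N is B_N 1, also A_N (F_N − X) = (m_t (1 − y_t))_t. Every m_t is
-- positive, so holomorphy of η^X and of F_N/η^X amounts to 0 ≤ y ≤ 1. And every X is
-- B_N y for exactly one y, namely y_t = (A_N X)_t / m_t.
module Submission where

open import Defs
open import Data.Nat using (ℕ; _≤_)
open import Data.Integer using (ℤ)
open import Data.Rational as ℚ using (ℚ; 0ℚ; 1ℚ)
open import Data.List.Membership.Propositional using (_∈_)
open import Data.Product using (∃; _×_)
open import Function.Bundles using (_⇔_)
open import Relation.Binary.PropositionalEquality using (_≡_)

import Data.Nat as ℕ
open import Data.Nat using (zero; suc; s≤s)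
import Data.Integer as ℤ
open import Data.Rational using (_+_; _*_; -_; _-_; 1/_; NonZero; Positive)
open import Data.Rational.Properties
open import Data.Rational.Solver using (module +-*-Solver)
open import Algebra.Bundles using (CommutativeMonoid)
open import Algebra.Properties.CommutativeSemigroup
  (CommutativeMonoid.commutativeSemigroup +-0-commutativeMonoid) using (interchange)
open import Data.List using (List; []; _∷_; map)
open import Data.List.Membership.Propositional using (_∉_)
open import Data.List.Relation.Unary.Any using (here; there)
import Data.List.Relation.Unary.All as All
open import Data.List.Relation.Unary.AllPairs using (_∷_)
open import Data.List.Relation.Unary.Unique.Propositional using (Unique)
import Data.List.Relation.Unary.Unique.Propositional.Properties as Unique
open import Data.Nat.Divisibility using (_∣?_)
open import Data.Product using (_,_; proj₁; proj₂)
open import Data.Empty using (⊥-elim)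
open import Relation.Nullary using (yes; no)
open import Relation.Binary.PropositionalEquality
  using (refl; sym; trans; cong; cong₂; subst; subst₂; _≢_; module ≡-Reasoning)
open import Function.Bundles using (mk⇔; module Equivalence)
open Equivalence

∑ : List ℕ → (ℕ → ℚ) → ℚ
∑ xs f = sumℚ (map f xs)

syntax ∑ xs (λ x → e) = ∑[ x ∈ xs ] e

∑-cong : ∀ xs {f g : ℕ → ℚ} → (∀ x → x ∈ xs → f x ≡ g x) → ∑ xs f ≡ ∑ xs g
∑-cong []       f≗g = refl
∑-cong (x ∷ xs) f≗g = cong₂ _+_ (f≗g x (here refl)) (∑-cong xs (λ y y∈xs → f≗g y (there y∈xs)))

∑-0 : ∀ xs → ∑[ x ∈ xs ] 0ℚ ≡ 0ℚ
∑-0 []       = refl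
∑-0 (x ∷ xs) = trans (+-identityˡ _) (∑-0 xs)

∑-distrib-+ : ∀ xs (f g : ℕ → ℚ) → ∑[ x ∈ xs ] (f x + g x) ≡ ∑ xs f + ∑ xs g
∑-distrib-+ []       f g = sym (+-identityˡ 0ℚ)
∑-distrib-+ (x ∷ xs) f g =
  trans (cong ((f x + g x) +_) (∑-distrib-+ xs f g)) (interchange (f x) (g x) (∑ xs f) (∑ xs g))

∑-neg : ∀ xs (f : ℕ → ℚ) → ∑[ x ∈ xs ] (- f x) ≡ - ∑ xs f
∑-neg []       f = refl
∑-neg (x ∷ xs) f = trans (cong (- f x +_) (∑-neg xs f)) (sym (neg-distrib-+ (f x) (∑ xs f)))

*-distribˡ-∑ : ∀ xs c (f : ℕ → ℚ) → c * ∑ xs f ≡ ∑[ x ∈ xs ] (c * f x)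
*-distribˡ-∑ []       c f = *-zeroʳ c
*-distribˡ-∑ (x ∷ xs) c f =
  trans (*-distribˡ-+ c (f x) (∑ xs f)) (cong (c * f x +_) (*-distribˡ-∑ xs c f))

*-distribʳ-∑ : ∀ xs c (f : ℕ → ℚ) → ∑ xs f * c ≡ ∑[ x ∈ xs ] (f x * c)
*-distribʳ-∑ []       c f = *-zeroˡ c
*-distribʳ-∑ (x ∷ xs) c f =
  trans (*-distribʳ-+ c (f x) (∑ xs f)) (cong (f x * c +_) (*-distribʳ-∑ xs c f))

∑-comm : ∀ xs ys (f : ℕ → ℕ → ℚ) →
  ∑[ x ∈ xs ] ∑[ y ∈ ys ] f x y ≡ ∑[ y ∈ ys ] ∑[ x ∈ xs ] f x y
∑-comm []       ys f = sym (∑-0 ys)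
∑-comm (x ∷ xs) ys f =
  trans (cong (∑ ys (f x) +_) (∑-comm xs ys f))
        (sym (∑-distrib-+ ys (f x) (λ y → ∑[ x ∈ xs ] f x y)))

δ-refl : ∀ t → δ t t ≡ 1ℚ
δ-refl t with t ℕ.≟ t
... | yes _   = refl
... | no  t≢t = ⊥-elim (t≢t refl)

δ-≢ : ∀ {t s} → t ≢ s → δ t s ≡ 0ℚ
δ-≢ {t} {s} t≢s with t ℕ.≟ s
... | yes t≡s = ⊥-elim (t≢s t≡s)
... | no  _   = refl

∑-δ-∉ : ∀ xs {t} (g : ℕ → ℚ) → t ∉ xs → ∑[ s ∈ xs ] (δ t s * g s) ≡ 0ℚ
∑-δ-∉ []       g t∉xs = refl
∑-δ-∉ (x ∷ xs) g t∉xs =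
  trans (cong₂ _+_ (trans (cong (_* g x) (δ-≢ (λ t≡x → t∉xs (here t≡x)))) (*-zeroˡ (g x)))
                   (∑-δ-∉ xs g (λ t∈xs → t∉xs (there t∈xs))))
        (+-identityˡ 0ℚ)

∑-δ : ∀ {xs t} (g : ℕ → ℚ) → Unique xs → t ∈ xs → ∑[ s ∈ xs ] (δ t s * g s) ≡ g t
∑-δ {x ∷ xs} g (x≢xs ∷ _) (here refl) =
  trans (cong₂ _+_ (trans (cong (_* g x) (δ-refl x)) (*-identityˡ (g x)))
                   (∑-δ-∉ xs g (λ x∈xs → All.lookup x≢xs x∈xs refl)))
        (+-identityʳ (g x))
∑-δ {x ∷ xs} {t} g (x≢xs ∷ unique) (there t∈xs) =
  trans (cong₂ _+_ (trans (cong (_* g x) (δ-≢ (λ t≡x → All.lookup x≢xs t∈xs (sym t≡x))))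
                          (*-zeroˡ (g x)))
                   (∑-δ g unique t∈xs))
        (+-identityˡ (g t))

∑-inverse : ∀ {xs t} (P Q : ℕ → ℕ → ℚ) (h : ℕ → ℚ) → Unique xs → t ∈ xs →
  (∀ s → s ∈ xs → ∑[ d ∈ xs ] (P t d * Q d s) ≡ δ t s) →
  ∑[ d ∈ xs ] (P t d * ∑[ s ∈ xs ] (Q d s * h s)) ≡ h t
∑-inverse {xs} {t} P Q h unique t∈xs PQ≡I = begin
  ∑[ d ∈ xs ] (P t d * ∑[ s ∈ xs ] (Q d s * h s))
    ≡⟨ ∑-cong xs (λ d _ → *-distribˡ-∑ xs (P t d) (λ s → Q d s * h s)) ⟩
  ∑[ d ∈ xs ] ∑[ s ∈ xs ] (P t d * (Q d s * h s))
    ≡⟨ ∑-comm xs xs (λ d s → P t d * (Q d s * h s)) ⟩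
  ∑[ s ∈ xs ] ∑[ d ∈ xs ] (P t d * (Q d s * h s))
    ≡⟨ ∑-cong xs (λ s _ → trans (∑-cong xs (λ d _ → sym (*-assoc (P t d) (Q d s) (h s))))
                              (sym (*-distribʳ-∑ xs (h s) (λ d → P t d * Q d s)))) ⟩
  ∑[ s ∈ xs ] (∑[ d ∈ xs ] (P t d * Q d s) * h s)
    ≡⟨ ∑-cong xs (λ s s∈xs → cong (_* h s) (PQ≡I s s∈xs)) ⟩
  ∑[ s ∈ xs ] (δ t s * h s)
    ≡⟨ ∑-δ h unique t∈xs ⟩
  h t ∎
  where open ≡-Reasoning

toℚ-positive : ∀ {n} → 1 ≤ n → Positive (toℚ (ℤ.+ n))
toℚ-positive {suc n} _ = normalize-pos (suc n) 1

0≤r*p⇔0≤p : ∀ r .{{_ : Positive r}} {p} → 0ℚ ℚ.≤ r * p ⇔ 0ℚ ℚ.≤ p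
0≤r*p⇔0≤p r {p} = mk⇔
  (λ 0≤rp → *-cancelˡ-≤-pos r (subst (ℚ._≤ r * p) (sym (*-zeroʳ r)) 0≤rp))
  (λ 0≤p → subst (ℚ._≤ r * p) (*-zeroʳ r) (*-monoˡ-≤-nonNeg r {{pos⇒nonNeg r}} 0≤p))

0≤q-p⇔p≤q : ∀ {p q} → 0ℚ ℚ.≤ q - p ⇔ p ℚ.≤ q
0≤q-p⇔p≤q {p} {q} = mk⇔
  (λ 0≤q-p → subst₂ ℚ._≤_ (+-identityˡ p) q-p+p≡q (+-monoˡ-≤ p 0≤q-p))
  (λ p≤q → subst (ℚ._≤ q - p) (+-inverseʳ p) (+-monoˡ-≤ (- p) p≤q))
  where
  q-p+p≡q : q - p + p ≡ q
  q-p+p≡q = trans (+-assoc q (- p) p) (trans (cong (q +_) (+-inverseˡ p)) (+-identityʳ q))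

toℚ-nonZero : ∀ {n} → 1 ≤ n → NonZero (toℚ (ℤ.+ n))
toℚ-nonZero {n} 1≤n = pos⇒nonZero (toℚ (ℤ.+ n)) {{toℚ-positive 1≤n}}

-- 1/n, with the junk value 0 at n = 0.
recipℕ : ℕ → ℚ
recipℕ zero    = 0ℚ
recipℕ (suc n) = (1/ toℚ (ℤ.+ suc n)) {{toℚ-nonZero {suc n} (s≤s ℕ.z≤n)}}

toℚ-*-recipℕ : ∀ {n} → 1 ≤ n → toℚ (ℤ.+ n) * recipℕ n ≡ 1ℚ
toℚ-*-recipℕ {suc n} 1≤n = *-inverseʳ (toℚ (ℤ.+ suc n)) {{toℚ-nonZero {suc n} 1≤n}}

divisors-unique : ∀ N → Unique (divisors N)
divisors-unique N = Unique.filter⁺ (_∣? N) (Unique.upTo⁺ (suc N))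

Holomorphic-resp : ∀ N {u v : QVec} → (∀ d → d ∈ divisors N → u d ≡ v d) →
  Holomorphic N u ⇔ Holomorphic N v
Holomorphic-resp N {u} {v} u≗v = mk⇔
  (λ hol t t∈D → subst (0ℚ ℚ.≤_) (A·-cong t) (hol t t∈D))
  (λ hol t t∈D → subst (0ℚ ℚ.≤_) (sym (A·-cong t)) (hol t t∈D))
  where
  A·-cong : ∀ t → mulVec N (A N) u t ≡ mulVec N (A N) v t
  A·-cong t = ∑-cong (divisors N) (λ d d∈D → cong (A N t d *_) (u≗v d d∈D))

module ScaledInverse (N : ℕ) (Ainv : QMat) (inverse : IsInverseA N Ainv)
                     (m : ℕ → ℕ) (m-pos : ∀ t → t ∈ divisors N → 1 ≤ m t) where

  private
    D : List ℕ
    D = divisors N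

    M : ℕ → ℚ
    M t = toℚ (ℤ.+ m t)

    open +-*-Solver

  A·B≡diag : ∀ g t → t ∈ D → mulVec N (A N) (mulVec N (B Ainv m) g) t ≡ M t * g t
  A·B≡diag g t t∈D =
    trans (∑-cong D (λ d _ → cong (A N t d *_) (∑-cong D (λ s _ → reassoc (M s) (Ainv d s) (g s)))))
          (∑-inverse (A N) Ainv (λ s → M s * g s) (divisors-unique N) t∈D
                     (λ s s∈D → proj₁ inverse t s t∈D s∈D))
    where
    reassoc : ∀ a b c → (a * b) * c ≡ b * (a * c)
    reassoc = solve 3 (λ a b c → (a :* b) :* c := b :* (a :* c)) refl

  Holomorphic-B·⇔ : ∀ g → Holomorphic N (mulVec N (B Ainv m) g) ⇔ (∀ t → t ∈ D → 0ℚ ℚ.≤ g t)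
  Holomorphic-B·⇔ g = mk⇔
    (λ hol t t∈D → to (0≤M*⇔0≤ t t∈D) (subst (0ℚ ℚ.≤_) (A·B≡diag g t t∈D) (hol t t∈D)))
    (λ g≥0 t t∈D → subst (0ℚ ℚ.≤_) (sym (A·B≡diag g t t∈D)) (from (0≤M*⇔0≤ t t∈D) (g≥0 t t∈D)))
    where
    0≤M*⇔0≤ : ∀ t → t ∈ D → 0ℚ ℚ.≤ M t * g t ⇔ 0ℚ ℚ.≤ g t
    0≤M*⇔0≤ t t∈D = 0≤r*p⇔0≤p (M t) {{toℚ-positive (m-pos t t∈D)}}

  FExp-B·y≡B·[1-y] : ∀ y d →
    FExp N Ainv m d - mulVec N (B Ainv m) y d ≡ mulVec N (B Ainv m) (λ t → 1ℚ - y t) d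
  FExp-B·y≡B·[1-y] y d = begin
    ∑ D (B Ainv m d) - ∑[ t ∈ D ] (B Ainv m d t * y t)
      ≡⟨ cong (∑ D (B Ainv m d) +_) (sym (∑-neg D (λ t → B Ainv m d t * y t))) ⟩
    ∑ D (B Ainv m d) + ∑[ t ∈ D ] (- (B Ainv m d t * y t))
      ≡⟨ sym (∑-distrib-+ D (B Ainv m d) (λ t → - (B Ainv m d t * y t))) ⟩
    ∑[ t ∈ D ] (B Ainv m d t + - (B Ainv m d t * y t))
      ≡⟨ ∑-cong D (λ t _ → sym (*-complement (B Ainv m d t) (y t))) ⟩
    ∑[ t ∈ D ] (B Ainv m d t * (1ℚ - y t)) ∎
    where
    open ≡-Reasoning
    *-complement : ∀ b p → b * (1ℚ - p) ≡ b + - (b * p)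
    *-complement b p =
      trans (*-distribˡ-+ b 1ℚ (- p)) (cong₂ _+_ (*-identityʳ b) (sym (neg-distribʳ-* b p)))

  B·[A·X/m]≡X : ∀ X d → d ∈ D →
    mulVec N (B Ainv m) (λ t → recipℕ (m t) * mulVec N (A N) X t) d ≡ X d
  B·[A·X/m]≡X X d d∈D =
    trans (∑-cong D (λ t t∈D → cancel-M t t∈D (Ainv d t) (mulVec N (A N) X t)))
          (∑-inverse Ainv (A N) X (divisors-unique N) d∈D (λ s s∈D → proj₂ inverse d s d∈D s∈D))
    where
    reassoc : ∀ a b r x → (a * b) * (r * x) ≡ b * ((a * r) * x)
    reassoc = solve 4 (λ a b r x → (a :* b) :* (r :* x) := b :* ((a :* r) :* x)) refl
    cancel-M : ∀ t → t ∈ D → ∀ b x → (M t * b) * (recipℕ (m t) * x) ≡ b * x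
    cancel-M t t∈D b x = begin
      (M t * b) * (recipℕ (m t) * x)  ≡⟨ reassoc (M t) b (recipℕ (m t)) x ⟩
      b * ((M t * recipℕ (m t)) * x)  ≡⟨ cong (λ c → b * (c * x)) (toℚ-*-recipℕ (m-pos t t∈D)) ⟩
      b * (1ℚ * x)                    ≡⟨ cong (b *_) (*-identityˡ x) ⟩
      b * x                           ∎
      where open ≡-Reasoning

  Holomorphic-pair⇔0≤y≤1 : ∀ X y → (∀ d → d ∈ D → X d ≡ mulVec N (B Ainv m) y d) →
    (Holomorphic N X × Holomorphic N (λ d → FExp N Ainv m d - X d))
    ⇔ (∀ t → t ∈ D → (0ℚ ℚ.≤ y t) × (y t ℚ.≤ 1ℚ))
  Holomorphic-pair⇔0≤y≤1 X y X≡B·y = mk⇔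
    (λ (holX , holF-X) t t∈D →
      to (Holomorphic-B·⇔ y) (to holX⇔ holX) t t∈D ,
      to (0≤q-p⇔p≤q {y t} {1ℚ}) (to (Holomorphic-B·⇔ (λ s → 1ℚ - y s)) (to holF-X⇔ holF-X) t t∈D))
    (λ bounds →
      from holX⇔ (from (Holomorphic-B·⇔ y) (λ t t∈D → proj₁ (bounds t t∈D))) ,
      from holF-X⇔ (from (Holomorphic-B·⇔ (λ s → 1ℚ - y s))
                          (λ t t∈D → from (0≤q-p⇔p≤q {y t} {1ℚ}) (proj₂ (bounds t t∈D)))))
    where
    holX⇔ : Holomorphic N X ⇔ Holomorphic N (mulVec N (B Ainv m) y)
    holX⇔ = Holomorphic-resp N X≡B·y
    holF-X⇔ : Holomorphic N (λ d → FExp N Ainv m d - X d)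
              ⇔ Holomorphic N (mulVec N (B Ainv m) (λ t → 1ℚ - y t))
    holF-X⇔ = Holomorphic-resp N (λ d d∈D →
      trans (cong (λ z → FExp N Ainv m d - z) (X≡B·y d d∈D)) (FExp-B·y≡B·[1-y] y d))

lemma1 : (N : ℕ) → 1 ≤ N →
    (Ainv : QMat) → IsInverseA N Ainv →
    (m : ℕ → ℕ) → (∀ t → t ∈ divisors N → IsMinMult N Ainv t (m t)) →
    (X : ZVec) →
    (Holomorphic N (λ d → toℚ (X d))
      × Holomorphic N (λ d → FExp N Ainv m d ℚ.- toℚ (X d)))
    ⇔ (∃ λ (y : QVec) →
        (∀ t → t ∈ divisors N → (0ℚ ℚ.≤ y t) × (y t ℚ.≤ 1ℚ))
        × (∀ d → d ∈ divisors N → toℚ (X d) ≡ ΣD N (λ t → B Ainv m d t ℚ.* y t)))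
lemma1 N _ Ainv inverse m minimal X = mk⇔
  (λ hol → y , to (Holomorphic-pair⇔0≤y≤1 Xℚ y X≡B·y) hol , X≡B·y)
  (λ (y , bounds , X≡B·y) → from (Holomorphic-pair⇔0≤y≤1 Xℚ y X≡B·y) bounds)
  where
  open ScaledInverse N Ainv inverse m (λ t t∈D → proj₁ (minimal t t∈D))
  Xℚ : QVec
  Xℚ d = toℚ (X d)
  y : QVec
  y t = recipℕ (m t) * mulVec N (A N) Xℚ t
  X≡B·y : ∀ d → d ∈ divisors N → Xℚ d ≡ mulVec N (B Ainv m) y d
  X≡B·y d d∈D = sym (B·[A·X/m]≡X Xℚ d d∈D)
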